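{- Let $k$ be a non-negative integer and $l$ a positive integer, and set \[Q_{k,l}(m,n)=(m+n)l+k\frac{n(n-1)}{2}+(n-1)mk+(k+1)\frac{m(m+1)}{2}.\] Then, as formal power series in $x,q$, \[ \sum_{\pi\in\mathcal{UG}_{k,l}}x^{\#(\pi)}q^{|\pi|}=\sum_{m,n\geq 0}\frac{x^{m+n}q^{Q_{k,l}(m,n)}}{(q;q)_m(q^2;q^2)_{\lfloor n/2\rfloor}} =\sum_{m,n\geq 0}\frac{x^{m+2n}q^{Q_{k,l}(m,2n)}\left(1+xq^{l+(m+2n)k}\right)}{(q;q)_m(q^2;q^2)_{n}}. \]
   Context: A partition is a finite non-decreasing sequence $\pi=(\lambda_1,\lambda_2,\dots,\lambda_{\#(\pi)})$ of positive integers (the empty sequence is the unique partition of $0$); $\#(\pi)$ is its number of parts and $|\pi|=\sum_i\lambda_i$ its norm. $\mathcal{UG}_{k,l}$ is the set of partitions with $\lambda_1\ge l$ and $\lambda_i-\lambda_{i-1}\ge k$ for $2\le i\le\#(\pi)$ (including the empty partition). $(a;q)_j=\prod_{i=0}^{j-1}(1-aq^i)$. -}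

module Defs where

open import Data.Nat using (ℕ; zero; suc; _+_; _*_; _∸_; _≤_; _<_; _/_; _≡ᵇ_; _%_)
open import Data.Nat.Properties using (_≤?_)
open import Data.Integer as ℤ using (ℤ; +_; -[1+_])
open import Data.List using (List; []; _∷_; length)
open import Data.List.Relation.Unary.All using (All)
open import Data.Unit using (⊤)
open import Data.Product using (_×_)
open import Data.Bool using (if_then_else_)
open import Relation.Nullary.Decidable using (yes; no)

Gaps : ℕ → List ℕ → Set
Gaps k []           = ⊤
Gaps k (x ∷ [])     = ⊤
Gaps k (x ∷ y ∷ xs) = (x + k ≤ y) × Gaps k (y ∷ xs)

IsPartition : List ℕ → Set
IsPartition π = All (0 <_) π × Gaps 0 π

HeadGeq : ℕ → List ℕ → Set
HeadGeq l []      = ⊤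
HeadGeq l (x ∷ _) = l ≤ x

UG : ℕ → ℕ → List ℕ → Set
UG k l π = IsPartition π × HeadGeq l π × Gaps k π

Series : Set
Series = ℕ → ℕ

sumTo : ℕ → (ℕ → ℕ) → ℕ
sumTo zero    f = f 0
sumTo (suc n) f = sumTo n f + f (suc n)

one : Series
one zero    = 1
one (suc _) = 0

_⊛_ : Series → Series → Series
(f ⊛ g) n = sumTo n (λ j → f j * g (n ∸ j))

-- 1/(1 - q^i) = Σ_j q^{ij}   (used for i ≥ 1)
geomInv : ℕ → Series
geomInv i n with i
... | zero  = one n
... | suc p = if (n % suc p) ≡ᵇ 0 then 1 else 0

prodSeries : ℕ → (ℕ → Series) → Series
prodSeries zero    h = one
prodSeries (suc m) h = prodSeries m h ⊛ h (suc m)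

invPochQ : ℕ → Series
invPochQ m = prodSeries m geomInv

invPochQ2 : ℕ → Series
invPochQ2 j = prodSeries j (λ i → geomInv (2 * i))

-- q^e · f for an integer exponent e (coefficient of q^M is f (M - e))
shiftBy : ℤ → Series → Series
shiftBy e f M with (+ M) ℤ.- e
... | + j      = f j
... | -[1+ _ ] = 0

Q : ℕ → ℕ → ℕ → ℕ → ℤ
Q k l m n =
  + ((m + n) * l) ℤ.+ + (k * ((n * (n ∸ 1)) / 2))
  ℤ.+ ((+ n) ℤ.- (+ 1)) ℤ.* (+ (m * k))
  ℤ.+ + ((k + 1) * ((m * (m + 1)) / 2))

-- Coefficient of x^N q^M in the two right-hand sides

rhs1 : ℕ → ℕ → ℕ → ℕ → ℕ
rhs1 k l N M =
  sumTo N (λ m → sumTo N (λ n →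
    if (m + n) ≡ᵇ N
    then shiftBy (Q k l m n) (invPochQ m ⊛ invPochQ2 (n / 2)) M
    else 0))

rhs2 : ℕ → ℕ → ℕ → ℕ → ℕ
rhs2 k l N M =
  sumTo N (λ m → sumTo N (λ n →
      (if (m + 2 * n) ≡ᵇ N
       then shiftBy (Q k l m (2 * n)) (invPochQ m ⊛ invPochQ2 n) M
       else 0)
    + (if (m + 2 * n + 1) ≡ᵇ N
       then shiftBy (Q k l m (2 * n) ℤ.+ + (l + (m + 2 * n) * k))
                    (invPochQ m ⊛ invPochQ2 n) M
       else 0)))

module Submission where

-- A partition in UG_{k,l} with N parts and norm M is its smallest part
-- y ≥ l followed by a partition in UG_{k,y+k} with N - 1 parts and norm M - y.
-- Enumerating by this recursion gives a duplicate-free list whose length is the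
-- coefficient of q^M in q^{Nl + kN(N-1)/2} / (q;q)_N (enum-length).
--
-- With X m j = q^{m(m-1)/2} / ((q;q)_m (q²;q²)_j), the diagonal sums
-- S r = Σ_{m+2j=r} X m j satisfy S_{r+1} = S_r + q^{r+1} S_{r+1}, the recurrence of
-- 1/(q;q)_r, hence S r = 1/(q;q)_r.  Splitting each X m j along the recurrence of
-- 1/(q;q)_m gives S N = Σ_{m+2j=N} term m j + Σ_{m+2j=N-1} term m j with
-- term m j = q^{m(m+1)/2} / ((q;q)_m (q²;q²)_j) (term-identity).
--
-- Q(m,n) = Nl + kN(N-1)/2 + m(m+1)/2 for N = m + n, so both
-- sums reduce, after re-indexing the finite double sums (by the parity of n, resp.
-- by the diagonals m + 2n = N and m + 2n + 1 = N), to q^{Nl + kN(N-1)/2} times the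
-- left-hand side of term-identity (rhs1-closed, rhs2-closed).

open import Defs
open import Data.Nat using (ℕ; zero; suc; _+_; _*_; _∸_; _≤_; _<_; _≡ᵇ_; _/_; _%_; z≤n; s≤s; NonZero; ⌊_/2⌋)
open import Data.Nat.Properties
open import Data.Nat.DivMod using ([m+n]%n≡m%n; m<n⇒m%n≡m; m*n/n≡m; m/n≡1+[m∸n]/n)
open import Data.Nat.ListAction using (sum)
open import Data.Nat.Tactic.RingSolver using (solve-∀)
import Data.Integer as ℤ using (_+_; _-_; _*_; -_; _⊖_)
open import Data.Integer using (-[1+_]) renaming (+_ to pos)
import Data.Integer.Properties as ℤP
import Data.Integer.Tactic.RingSolver as ℤSolver
open import Data.Bool using (true; false; if_then_else_; T)
open import Data.Empty using (⊥-elim)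
open import Data.Unit using (tt)
open import Data.Product using (Σ; _×_; _,_; ∃)
open import Data.Sum using (inj₁; inj₂)
open import Data.List using (List; []; _∷_; _++_; map; length)
open import Data.List.Properties using (length-++; length-map; ∷-injectiveˡ; ∷-injectiveʳ)
open import Data.List.Relation.Unary.All using (All; []; _∷_)
open import Data.List.Relation.Unary.AllPairs using ([]; _∷_)
open import Data.List.Relation.Unary.Any using (here)
open import Data.List.Membership.Propositional using (_∈_)
open import Data.List.Membership.Propositional.Properties using (∈-++⁺ˡ; ∈-++⁺ʳ; ∈-++⁻; ∈-map⁺; ∈-map⁻)
open import Data.List.Relation.Unary.Unique.Propositional using (Unique)
import Data.List.Relation.Unary.Unique.Propositional.Properties as Unique
open import Function using (_∘_)
open import Function.Bundles using (_⇔_; mk⇔)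
import Function.Properties.Equivalence as ⇔
open import Relation.Nullary using (¬_; yes; no)
open import Relation.Binary.PropositionalEquality
open import Algebra.Properties.CommutativeSemigroup +-commutativeSemigroup
  using (interchange)
open ≡-Reasoning

infixl 6 _⊕_

_⊕_ : Series → Series → Series
(f ⊕ g) n = f n + g n

zeroS : Series
zeroS _ = 0

-- q^i · f.  Defined by recursion on i so that it computes on numerals.
shift : ℕ → Series → Series
shift zero    f n       = f n
shift (suc i) f zero    = 0
shift (suc i) f (suc n) = shift i f n

shift-at : ∀ i f d → shift i f (i + d) ≡ f d
shift-at zero    f d = refl
shift-at (suc i) f d = shift-at i f d

shift-below : ∀ i f n → n < i → shift i f n ≡ 0
shift-below (suc i) f zero    _       = refl
shift-below (suc i) f (suc n) (s≤s p) = shift-below i f n p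

shift-≥ : ∀ i f n → i ≤ n → shift i f n ≡ f (n ∸ i)
shift-≥ i f n i≤n = begin
  shift i f n             ≡⟨ cong (shift i f) (sym (m+[n∸m]≡n i≤n)) ⟩
  shift i f (i + (n ∸ i)) ≡⟨ shift-at i f (n ∸ i) ⟩
  f (n ∸ i)               ∎

shift-index : ∀ {i j} f → i ≡ j → shift i f ≗ shift j f
shift-index f refl n = refl

shift-cong : ∀ i {f g} → f ≗ g → shift i f ≗ shift i g
shift-cong zero    e n       = e n
shift-cong (suc i) e zero    = refl
shift-cong (suc i) e (suc n) = shift-cong i e n

shift-shift : ∀ i j f → shift i (shift j f) ≗ shift (i + j) f
shift-shift zero    j f n       = refl
shift-shift (suc i) j f zero    = refl
shift-shift (suc i) j f (suc n) = shift-shift i j f n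

shift-⊕ : ∀ i f g → shift i (f ⊕ g) ≗ shift i f ⊕ shift i g
shift-⊕ zero    f g n       = refl
shift-⊕ (suc i) f g zero    = refl
shift-⊕ (suc i) f g (suc n) = shift-⊕ i f g n

shift-zeroS : ∀ i → shift i zeroS ≗ zeroS
shift-zeroS zero    n       = refl
shift-zeroS (suc i) zero    = refl
shift-zeroS (suc i) (suc n) = shift-zeroS i n

sumTo-cong : ∀ n {f g : ℕ → ℕ} → (∀ j → j ≤ n → f j ≡ g j) → sumTo n f ≡ sumTo n g
sumTo-cong zero    e = e 0 z≤n
sumTo-cong (suc n) e = cong₂ _+_ (sumTo-cong n (λ j p → e j (m≤n⇒m≤1+n p))) (e (suc n) ≤-refl)

sumTo-+ : ∀ n (f g : ℕ → ℕ) → sumTo n (λ j → f j + g j) ≡ sumTo n f + sumTo n g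
sumTo-+ zero    f g = refl
sumTo-+ (suc n) f g = begin
  sumTo n (λ j → f j + g j) + (f (suc n) + g (suc n))
    ≡⟨ cong (_+ (f (suc n) + g (suc n))) (sumTo-+ n f g) ⟩
  sumTo n f + sumTo n g + (f (suc n) + g (suc n))
    ≡⟨ interchange (sumTo n f) (sumTo n g) (f (suc n)) (g (suc n)) ⟩
  sumTo n f + f (suc n) + (sumTo n g + g (suc n)) ∎

sumTo-zero : ∀ n (f : ℕ → ℕ) → (∀ j → j ≤ n → f j ≡ 0) → sumTo n f ≡ 0
sumTo-zero zero    f e = e 0 z≤n
sumTo-zero (suc n) f e =
  cong₂ _+_ (sumTo-zero n f (λ j p → e j (m≤n⇒m≤1+n p))) (e (suc n) ≤-refl)

sumTo-suc : ∀ n (f : ℕ → ℕ) → sumTo (suc n) f ≡ f 0 + sumTo n (f ∘ suc)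
sumTo-suc zero    f = refl
sumTo-suc (suc n) f = begin
  sumTo (suc n) f + f (suc (suc n))         ≡⟨ cong (_+ f (suc (suc n))) (sumTo-suc n f) ⟩
  f 0 + sumTo n (f ∘ suc) + f (suc (suc n)) ≡⟨ +-assoc (f 0) _ _ ⟩
  f 0 + (sumTo n (f ∘ suc) + f (suc (suc n))) ∎

sumTo-reverse : ∀ n (f : ℕ → ℕ) → sumTo n f ≡ sumTo n (λ j → f (n ∸ j))
sumTo-reverse zero    f = refl
sumTo-reverse (suc n) f = begin
  sumTo n f + f (suc n)                   ≡⟨ cong (_+ f (suc n)) (sumTo-reverse n f) ⟩
  sumTo n (λ j → f (n ∸ j)) + f (suc n)   ≡⟨ +-comm _ (f (suc n)) ⟩
  f (suc n) + sumTo n (λ j → f (n ∸ j))   ≡⟨ sym (sumTo-suc n (λ j → f (suc n ∸ j))) ⟩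
  sumTo (suc n) (λ j → f (suc n ∸ j))     ∎

sumTo-swap : ∀ A B (f : ℕ → ℕ → ℕ) →
  sumTo A (λ i → sumTo B (f i)) ≡ sumTo B (λ j → sumTo A (λ i → f i j))
sumTo-swap zero    B f = refl
sumTo-swap (suc A) B f = begin
  sumTo A (λ i → sumTo B (f i)) + sumTo B (f (suc A))
    ≡⟨ cong (_+ sumTo B (f (suc A))) (sumTo-swap A B f) ⟩
  sumTo B (λ j → sumTo A (λ i → f i j)) + sumTo B (f (suc A))
    ≡⟨ sym (sumTo-+ B (λ j → sumTo A (λ i → f i j)) (f (suc A))) ⟩
  sumTo B (λ j → sumTo A (λ i → f i j) + f (suc A) j) ∎

sumTo-single : ∀ K c (f : ℕ → ℕ) → c ≤ K → (∀ j → j ≤ K → j ≢ c → f j ≡ 0) → sumTo K f ≡ f c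
sumTo-single zero    zero f z≤n e = refl
sumTo-single (suc K) c    f c≤1+K e with c ≤? K
... | yes c≤K = begin
  sumTo K f + f (suc K) ≡⟨ cong₂ _+_ (sumTo-single K c f c≤K (λ j p → e j (m≤n⇒m≤1+n p)))
                                     (e (suc K) ≤-refl (λ eq → 1+n≰n (subst (_≤ K) (sym eq) c≤K))) ⟩
  f c + 0               ≡⟨ +-identityʳ (f c) ⟩
  f c                   ∎
... | no c≰K = begin
  sumTo K f + f (suc K) ≡⟨ cong (_+ f (suc K)) (sumTo-zero K f (λ j p → e j (m≤n⇒m≤1+n p) (λ { refl → c≰K p }))) ⟩
  f (suc K)             ≡⟨ cong f (≤-antisym (≰⇒> c≰K) c≤1+K) ⟩
  f c                   ∎

sumTo-shift : ∀ N b (H : ℕ → Series) M →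
  sumTo N (λ n → shift b (H n) M) ≡ shift b (λ T → sumTo N (λ n → H n T)) M
sumTo-shift N zero    H M       = refl
sumTo-shift N (suc b) H zero    = sumTo-zero N _ (λ _ _ → refl)
sumTo-shift N (suc b) H (suc M) = sumTo-shift N b H M

⊛-comm : ∀ f g → f ⊛ g ≗ g ⊛ f
⊛-comm f g n = begin
  sumTo n (λ j → f j * g (n ∸ j))                 ≡⟨ sumTo-reverse n _ ⟩
  sumTo n (λ j → f (n ∸ j) * g (n ∸ (n ∸ j)))     ≡⟨ sumTo-cong n swap ⟩
  sumTo n (λ j → g j * f (n ∸ j))                 ∎
  where
  swap : ∀ j → j ≤ n → f (n ∸ j) * g (n ∸ (n ∸ j)) ≡ g j * f (n ∸ j)
  swap j j≤n = trans (cong (λ i → f (n ∸ j) * g i) (m∸[m∸n]≡n j≤n)) (*-comm (f (n ∸ j)) (g j))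

⊛-congˡ : ∀ {f f′} g → f ≗ f′ → f ⊛ g ≗ f′ ⊛ g
⊛-congˡ g ef n = sumTo-cong n (λ j _ → cong (_* g (n ∸ j)) (ef j))

⊛-congʳ : ∀ f {g g′} → g ≗ g′ → f ⊛ g ≗ f ⊛ g′
⊛-congʳ f eg n = sumTo-cong n (λ j _ → cong (f j *_) (eg (n ∸ j)))

⊛-distribˡ : ∀ f g h → f ⊛ (g ⊕ h) ≗ (f ⊛ g) ⊕ (f ⊛ h)
⊛-distribˡ f g h n =
  trans (sumTo-cong n (λ j _ → *-distribˡ-+ (f j) (g (n ∸ j)) (h (n ∸ j)))) (sumTo-+ n _ _)

⊛-distribʳ : ∀ f g h → (f ⊕ g) ⊛ h ≗ (f ⊛ h) ⊕ (g ⊛ h)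
⊛-distribʳ f g h n = begin
  ((f ⊕ g) ⊛ h) n       ≡⟨ ⊛-comm (f ⊕ g) h n ⟩
  (h ⊛ (f ⊕ g)) n       ≡⟨ ⊛-distribˡ h f g n ⟩
  (h ⊛ f) n + (h ⊛ g) n ≡⟨ cong₂ _+_ (⊛-comm h f n) (⊛-comm h g n) ⟩
  (f ⊛ h) n + (g ⊛ h) n ∎

⊛-oneʳ : ∀ f → f ⊛ one ≗ f
⊛-oneʳ f zero    = *-identityʳ (f 0)
⊛-oneʳ f (suc n) = begin
  sumTo n (λ j → f j * one (suc n ∸ j)) + f (suc n) * one (suc n ∸ suc n)
    ≡⟨ cong₂ _+_ (sumTo-zero n _ (λ j j≤n → trans (cong (λ i → f j * one i) (+-∸-assoc 1 j≤n)) (*-zeroʳ (f j))))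
                 (trans (cong (λ i → f (suc n) * one i) (n∸n≡0 n)) (*-identityʳ (f (suc n)))) ⟩
  f (suc n) ∎

⊛-shift1ʳ : ∀ f g → f ⊛ shift 1 g ≗ shift 1 (f ⊛ g)
⊛-shift1ʳ f g zero    = *-zeroʳ (f 0)
⊛-shift1ʳ f g (suc n) = begin
  sumTo n (λ j → f j * shift 1 g (suc n ∸ j)) + f (suc n) * shift 1 g (suc n ∸ suc n)
    ≡⟨ cong₂ _+_ (sumTo-cong n (λ j j≤n → cong (λ i → f j * shift 1 g i) (+-∸-assoc 1 j≤n)))
                 (trans (cong (λ i → f (suc n) * shift 1 g i) (n∸n≡0 n)) (*-zeroʳ (f (suc n)))) ⟩
  sumTo n (λ j → f j * g (n ∸ j)) + 0 ≡⟨ +-identityʳ _ ⟩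
  sumTo n (λ j → f j * g (n ∸ j)) ∎

⊛-shiftʳ : ∀ i f g → f ⊛ shift i g ≗ shift i (f ⊛ g)
⊛-shiftʳ zero    f g n = refl
⊛-shiftʳ (suc i) f g n = begin
  (f ⊛ shift (suc i) g) n     ≡⟨ ⊛-congʳ f (shift-shift 1 i g) n ⟨
  (f ⊛ shift 1 (shift i g)) n ≡⟨ ⊛-shift1ʳ f (shift i g) n ⟩
  shift 1 (f ⊛ shift i g) n   ≡⟨ shift-cong 1 (⊛-shiftʳ i f g) n ⟩
  shift 1 (shift i (f ⊛ g)) n ≡⟨ shift-shift 1 i (f ⊛ g) n ⟩
  shift (suc i) (f ⊛ g) n     ∎

⊛-shiftˡ : ∀ i f g → shift i f ⊛ g ≗ shift i (f ⊛ g)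
⊛-shiftˡ i f g n = begin
  (shift i f ⊛ g) n ≡⟨ ⊛-comm (shift i f) g n ⟩
  (g ⊛ shift i f) n ≡⟨ ⊛-shiftʳ i g f n ⟩
  shift i (g ⊛ f) n ≡⟨ shift-cong i (⊛-comm g f) n ⟩
  shift i (f ⊛ g) n ∎

geomInv-unfold : ∀ i .{{_ : NonZero i}} → geomInv i ≗ one ⊕ shift i (geomInv i)
geomInv-unfold i@(suc p) n with n <? i
... | yes n<i = begin
  geomInv i n                  ≡⟨ below n n<i ⟩
  one n                        ≡⟨ +-identityʳ (one n) ⟨
  one n + 0                    ≡⟨ cong (one n +_) (shift-below i (geomInv i) n n<i) ⟨
  one n + shift i (geomInv i) n ∎
  where
  below : ∀ n → n < i → geomInv i n ≡ one n
  below zero    _   = refl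
  below (suc n) n<i rewrite m<n⇒m%n≡m n<i = refl
... | no n≮i with m≤n⇒∃[o]m+o≡n (≮⇒≥ n≮i)
...   | d , refl = begin
  geomInv i (i + d)              ≡⟨ cong (λ r → if r ≡ᵇ 0 then 1 else 0) (trans (cong (_% i) (+-comm i d)) ([m+n]%n≡m%n d i)) ⟩
  geomInv i d                    ≡⟨ shift-at i (geomInv i) d ⟨
  one (i + d) + shift i (geomInv i) (i + d) ∎

⊛-geomInv : ∀ F i .{{_ : NonZero i}} → F ⊛ geomInv i ≗ F ⊕ shift i (F ⊛ geomInv i)
⊛-geomInv F i n = begin
  (F ⊛ geomInv i) n                        ≡⟨ ⊛-congʳ F (geomInv-unfold i) n ⟩
  (F ⊛ (one ⊕ shift i (geomInv i))) n      ≡⟨ ⊛-distribˡ F one (shift i (geomInv i)) n ⟩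
  (F ⊛ one) n + (F ⊛ shift i (geomInv i)) n ≡⟨ cong₂ _+_ (⊛-oneʳ F n) (⊛-shiftʳ i F (geomInv i) n) ⟩
  F n + shift i (F ⊛ geomInv i) n           ∎

invPochQ-unfold : ∀ m → invPochQ (suc m) ≗ invPochQ m ⊕ shift (suc m) (invPochQ (suc m))
invPochQ-unfold m = ⊛-geomInv (invPochQ m) (suc m)

invPochQ2-unfold : ∀ j → invPochQ2 (suc j) ≗ invPochQ2 j ⊕ shift (2 * suc j) (invPochQ2 (suc j))
invPochQ2-unfold j = ⊛-geomInv (invPochQ2 j) (2 * suc j)

shift-fixpoint-unique : ∀ i (F G G′ : Series) →
  G ≗ F ⊕ shift (suc i) G → G′ ≗ F ⊕ shift (suc i) G′ → G ≗ G′
shift-fixpoint-unique i F G G′ eq eq′ n = go (suc n) n ≤-refl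
  where
  go : ∀ b n → n < b → G n ≡ G′ n
  go (suc b) n (s≤s n≤b) with n <? suc i
  ... | yes n<1+i = begin
    G n                       ≡⟨ eq n ⟩
    F n + shift (suc i) G n   ≡⟨ cong (F n +_) (trans (shift-below (suc i) G n n<1+i) (sym (shift-below (suc i) G′ n n<1+i))) ⟩
    F n + shift (suc i) G′ n  ≡⟨ eq′ n ⟨
    G′ n                      ∎
  ... | no n≮1+i = begin
    G n                      ≡⟨ eq n ⟩
    F n + shift (suc i) G n  ≡⟨ cong (F n +_) (shift-≥ (suc i) G n 1+i≤n) ⟩
    F n + G (n ∸ suc i)      ≡⟨ cong (F n +_) (go b (n ∸ suc i) smaller) ⟩
    F n + G′ (n ∸ suc i)     ≡⟨ cong (F n +_) (shift-≥ (suc i) G′ n 1+i≤n) ⟨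
    F n + shift (suc i) G′ n ≡⟨ eq′ n ⟨
    G′ n                     ∎
    where
    1+i≤n : suc i ≤ n
    1+i≤n = ≮⇒≥ n≮1+i
    smaller : n ∸ suc i < b
    smaller = <-≤-trans (∸-monoʳ-< (s≤s z≤n) 1+i≤n) n≤b

tri : ℕ → ℕ
tri zero    = 0
tri (suc m) = tri m + suc m

pairs : ℕ → ℕ
pairs zero    = 0
pairs (suc m) = tri m

tri≡m+pairs : ∀ m → tri m ≡ m + pairs m
tri≡m+pairs zero    = refl
tri≡m+pairs (suc m) = +-comm (tri m) (suc m)

X : ℕ → ℕ → Series
X m j = shift (pairs m) (invPochQ m) ⊛ invPochQ2 j

Y : ℕ → ℕ → Series
Y m j = shift m (X m j)

X-unfoldᵐ : ∀ m j → X (suc m) j ≗ Y m j ⊕ Y (suc m) j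
X-unfoldᵐ m j n = begin
  X (suc m) j n
    ≡⟨ ⊛-congˡ (B j) split n ⟩
  ((shift m (shift (pairs m) (A m)) ⊕ shift (suc m) (shift (tri m) (A (suc m)))) ⊛ B j) n
    ≡⟨ ⊛-distribʳ (shift m (shift (pairs m) (A m))) (shift (suc m) (shift (tri m) (A (suc m)))) (B j) n ⟩
  (shift m (shift (pairs m) (A m)) ⊛ B j) n + (shift (suc m) (shift (tri m) (A (suc m))) ⊛ B j) n
    ≡⟨ cong₂ _+_ (⊛-shiftˡ m (shift (pairs m) (A m)) (B j) n) (⊛-shiftˡ (suc m) (shift (tri m) (A (suc m))) (B j) n) ⟩
  Y m j n + Y (suc m) j n ∎
  where
  A = invPochQ
  B = invPochQ2
  split : shift (tri m) (A (suc m)) ≗ shift m (shift (pairs m) (A m)) ⊕ shift (suc m) (shift (tri m) (A (suc m)))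
  split t = begin
    shift (tri m) (A (suc m)) t
      ≡⟨ shift-cong (tri m) (invPochQ-unfold m) t ⟩
    shift (tri m) (A m ⊕ shift (suc m) (A (suc m))) t
      ≡⟨ shift-⊕ (tri m) (A m) _ t ⟩
    shift (tri m) (A m) t + shift (tri m) (shift (suc m) (A (suc m))) t
      ≡⟨ cong₂ _+_ (shift-index (A m) (tri≡m+pairs m) t) (shift-shift (tri m) (suc m) _ t) ⟩
    shift (m + pairs m) (A m) t + shift (tri m + suc m) (A (suc m)) t
      ≡⟨ cong (shift (m + pairs m) (A m) t +_) (shift-index (A (suc m)) (+-comm (tri m) (suc m)) t) ⟩
    shift (m + pairs m) (A m) t + shift (suc m + tri m) (A (suc m)) t
      ≡⟨ cong₂ _+_ (shift-shift m (pairs m) (A m) t) (shift-shift (suc m) (tri m) _ t) ⟨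
    shift m (shift (pairs m) (A m)) t + shift (suc m) (shift (tri m) (A (suc m))) t ∎

X-unfoldʲ : ∀ m j → X m (suc j) ≗ X m j ⊕ shift (2 * suc j) (X m (suc j))
X-unfoldʲ m j n = begin
  (a ⊛ invPochQ2 (suc j)) n
    ≡⟨ ⊛-congʳ a (invPochQ2-unfold j) n ⟩
  (a ⊛ (invPochQ2 j ⊕ shift (2 * suc j) (invPochQ2 (suc j)))) n
    ≡⟨ ⊛-distribˡ a (invPochQ2 j) (shift (2 * suc j) (invPochQ2 (suc j))) n ⟩
  X m j n + (a ⊛ shift (2 * suc j) (invPochQ2 (suc j))) n
    ≡⟨ cong (X m j n +_) (⊛-shiftʳ (2 * suc j) a (invPochQ2 (suc j)) n) ⟩
  X m j n + shift (2 * suc j) (X m (suc j)) n ∎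
  where
  a = shift (pairs m) (invPochQ m)

lowerᵐ : (ℕ → ℕ → Series) → ℕ → ℕ → Series
lowerᵐ H zero    j = zeroS
lowerᵐ H (suc m) j = H m j

lowerʲ : (ℕ → ℕ → Series) → ℕ → ℕ → Series
lowerʲ H m zero    = zeroS
lowerʲ H m (suc j) = H m j

X-split : ∀ m j → X m j ≗ Y m j ⊕ lowerᵐ Y m j
X-split zero    j n = sym (+-identityʳ (X 0 j n))
X-split (suc m) j n = trans (X-unfoldᵐ m j n) (+-comm (Y m j n) (Y (suc m) j n))

X-recurrence : ∀ m j → 1 ≤ m + 2 * j →
  X m j ≗ (lowerᵐ Y m j ⊕ lowerʲ Y m j) ⊕ shift (m + 2 * j) (X m j)
X-recurrence zero    (suc j) _ = X-unfoldʲ 0 j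
X-recurrence (suc m) zero    _ n = begin
  X (suc m) 0 n                                      ≡⟨ X-unfoldᵐ m 0 n ⟩
  Y m 0 n + shift (suc m) (X (suc m) 0) n            ≡⟨ cong₂ _+_ (+-identityʳ (Y m 0 n)) (shift-index (X (suc m) 0) (+-identityʳ (suc m)) n) ⟨
  Y m 0 n + 0 + shift (suc m + 0) (X (suc m) 0) n    ∎
X-recurrence (suc m) (suc j) _ n = begin
  X (suc m) (suc j) n
    ≡⟨ X-unfoldᵐ m (suc j) n ⟩
  Y m (suc j) n + shift (suc m) (X (suc m) (suc j)) n
    ≡⟨ cong (Y m (suc j) n +_) (shift-cong (suc m) (X-unfoldʲ (suc m) j) n) ⟩
  Y m (suc j) n + shift (suc m) (X (suc m) j ⊕ shift (2 * suc j) (X (suc m) (suc j))) n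
    ≡⟨ cong (Y m (suc j) n +_) (shift-⊕ (suc m) (X (suc m) j) _ n) ⟩
  Y m (suc j) n + (Y (suc m) j n + shift (suc m) (shift (2 * suc j) (X (suc m) (suc j))) n)
    ≡⟨ cong (λ x → Y m (suc j) n + (Y (suc m) j n + x)) (shift-shift (suc m) (2 * suc j) _ n) ⟩
  Y m (suc j) n + (Y (suc m) j n + shift (suc m + 2 * suc j) (X (suc m) (suc j)) n)
    ≡⟨ +-assoc (Y m (suc j) n) _ _ ⟨
  Y m (suc j) n + Y (suc m) j n + shift (suc m + 2 * suc j) (X (suc m) (suc j)) n ∎

-- Diagonal sums  Diag r H = Σ_{m + 2j = r} H m j, by peeling off the term j = 0.
Diag : ℕ → (ℕ → ℕ → Series) → Series
Diag zero          H = H 0 0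
Diag (suc zero)    H = H 1 0
Diag (suc (suc r)) H = H (suc (suc r)) 0 ⊕ Diag r (λ m j → H m (suc j))

Diag⁻ : ℕ → (ℕ → ℕ → Series) → Series
Diag⁻ zero    H = zeroS
Diag⁻ (suc r) H = Diag r H

diag-step : ∀ m j → m + 2 * suc j ≡ suc (suc (m + 2 * j))
diag-step m j = begin
  m + 2 * suc j             ≡⟨ cong (m +_) (*-suc 2 j) ⟩
  m + suc (suc (2 * j))     ≡⟨ +-suc m (suc (2 * j)) ⟩
  suc (m + suc (2 * j))     ≡⟨ cong suc (+-suc m (2 * j)) ⟩
  suc (suc (m + 2 * j))     ∎

Diag-cong : ∀ r {H G} → (∀ m j → m + 2 * j ≡ r → H m j ≗ G m j) → Diag r H ≗ Diag r G
Diag-cong zero          e = e 0 0 refl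
Diag-cong (suc zero)    e = e 1 0 refl
Diag-cong (suc (suc r)) e n = cong₂ _+_ (e (suc (suc r)) 0 (+-identityʳ _) n)
  (Diag-cong r (λ m j eq → e m (suc j) (trans (diag-step m j) (cong (suc ∘ suc) eq))) n)

Diag-⊕ : ∀ r H G → Diag r (λ m j → H m j ⊕ G m j) ≗ Diag r H ⊕ Diag r G
Diag-⊕ zero          H G n = refl
Diag-⊕ (suc zero)    H G n = refl
Diag-⊕ (suc (suc r)) H G n = begin
  H (suc (suc r)) 0 n + G (suc (suc r)) 0 n + Diag r (λ m j → H m (suc j) ⊕ G m (suc j)) n
    ≡⟨ cong (H (suc (suc r)) 0 n + G (suc (suc r)) 0 n +_) (Diag-⊕ r (λ m j → H m (suc j)) (λ m j → G m (suc j)) n) ⟩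
  H (suc (suc r)) 0 n + G (suc (suc r)) 0 n + (Diag r (λ m j → H m (suc j)) n + Diag r (λ m j → G m (suc j)) n)
    ≡⟨ interchange (H (suc (suc r)) 0 n) (G (suc (suc r)) 0 n) _ _ ⟩
  H (suc (suc r)) 0 n + Diag r (λ m j → H m (suc j)) n + (G (suc (suc r)) 0 n + Diag r (λ m j → G m (suc j)) n) ∎

Diag-shift : ∀ r i H → Diag r (λ m j → shift i (H m j)) ≗ shift i (Diag r H)
Diag-shift zero          i H n = refl
Diag-shift (suc zero)    i H n = refl
Diag-shift (suc (suc r)) i H n =
  trans (cong (shift i (H (suc (suc r)) 0) n +_) (Diag-shift r i (λ m j → H m (suc j)) n))
        (sym (shift-⊕ i (H (suc (suc r)) 0) (Diag r (λ m j → H m (suc j))) n))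

Diag-lowerᵐ : ∀ r H → Diag r (lowerᵐ H) ≗ Diag⁻ r H
Diag-lowerᵐ zero                H n = refl
Diag-lowerᵐ (suc zero)          H n = refl
Diag-lowerᵐ (suc (suc zero))    H n = +-identityʳ _
Diag-lowerᵐ (suc (suc (suc r))) H n = cong (H (suc (suc r)) 0 n +_) (begin
  Diag (suc r) (λ m j → lowerᵐ H m (suc j)) n     ≡⟨ Diag-cong (suc r) (λ m j _ → commute m j) n ⟩
  Diag (suc r) (lowerᵐ (λ m j → H m (suc j))) n   ≡⟨ Diag-lowerᵐ (suc r) (λ m j → H m (suc j)) n ⟩
  Diag r (λ m j → H m (suc j)) n                  ∎)
  where
  commute : ∀ m j → lowerᵐ H m (suc j) ≗ lowerᵐ (λ m j → H m (suc j)) m j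
  commute zero    j n = refl
  commute (suc m) j n = refl

Diag-lowerʲ : ∀ r H → Diag (suc r) (lowerʲ H) ≗ Diag⁻ r H
Diag-lowerʲ zero    H n = refl
Diag-lowerʲ (suc r) H n = refl

S : ℕ → Series
S r = Diag r X

S-split : ∀ r → S r ≗ Diag r Y ⊕ Diag⁻ r Y
S-split r n = begin
  Diag r X n                              ≡⟨ Diag-cong r (λ m j _ → X-split m j) n ⟩
  Diag r (λ m j → Y m j ⊕ lowerᵐ Y m j) n ≡⟨ Diag-⊕ r Y (lowerᵐ Y) n ⟩
  Diag r Y n + Diag r (lowerᵐ Y) n        ≡⟨ cong (Diag r Y n +_) (Diag-lowerᵐ r Y n) ⟩
  Diag r Y n + Diag⁻ r Y n                ∎

-- Summing X-recurrence along the diagonal r + 1, the lower terms add up to S r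
-- by S-split, so S (r+1) = S r + q^{r+1} S (r+1).
S-unfold : ∀ r → S (suc r) ≗ S r ⊕ shift (suc r) (S (suc r))
S-unfold r n = begin
  Diag (suc r) X n
    ≡⟨ Diag-cong (suc r) recurrence n ⟩
  Diag (suc r) (λ m j → lower m j ⊕ shift (suc r) (X m j)) n
    ≡⟨ Diag-⊕ (suc r) lower (λ m j → shift (suc r) (X m j)) n ⟩
  Diag (suc r) lower n + Diag (suc r) (λ m j → shift (suc r) (X m j)) n
    ≡⟨ cong₂ _+_ (Diag-⊕ (suc r) (lowerᵐ Y) (lowerʲ Y) n) (Diag-shift (suc r) (suc r) X n) ⟩
  Diag (suc r) (lowerᵐ Y) n + Diag (suc r) (lowerʲ Y) n + shift (suc r) (S (suc r)) n
    ≡⟨ cong (_+ shift (suc r) (S (suc r)) n) (cong₂ _+_ (Diag-lowerᵐ (suc r) Y n) (Diag-lowerʲ r Y n)) ⟩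
  Diag r Y n + Diag⁻ r Y n + shift (suc r) (S (suc r)) n
    ≡⟨ cong (_+ shift (suc r) (S (suc r)) n) (S-split r n) ⟨
  S r n + shift (suc r) (S (suc r)) n ∎
  where
  lower : ℕ → ℕ → Series
  lower m j = lowerᵐ Y m j ⊕ lowerʲ Y m j
  recurrence : ∀ m j → m + 2 * j ≡ suc r → X m j ≗ lower m j ⊕ shift (suc r) (X m j)
  recurrence m j eq t = trans (X-recurrence m j (subst (1 ≤_) (sym eq) (s≤s z≤n)) t)
                              (cong (lower m j t +_) (shift-index (X m j) eq t))

-- Σ_{m+2j=r} q^{m(m-1)/2} / ((q;q)_m (q²;q²)_j) = 1/(q;q)_r, since both sides
-- satisfy the recurrence G_{r+1} = G_r + q^{r+1} G_{r+1}.
S≗invPochQ : ∀ r → S r ≗ invPochQ r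
S≗invPochQ zero    = ⊛-oneʳ one
S≗invPochQ (suc r) = shift-fixpoint-unique r (invPochQ r) (S (suc r)) (invPochQ (suc r))
  (λ n → trans (S-unfold r n) (cong (_+ shift (suc r) (S (suc r)) n) (S≗invPochQ r n)))
  (invPochQ-unfold r)

-- The summand of both right-hand sides once the common factor q^{Nl + kN(N-1)/2}
-- is removed: q^{m(m+1)/2} / ((q;q)_m (q²;q²)_j).
term : ℕ → ℕ → Series
term m j = shift (tri m) (invPochQ m ⊛ invPochQ2 j)

term≗Y : ∀ m j → term m j ≗ Y m j
term≗Y m j n = begin
  shift (tri m) (A ⊛ B) n             ≡⟨ shift-index (A ⊛ B) (tri≡m+pairs m) n ⟩
  shift (m + pairs m) (A ⊛ B) n       ≡⟨ shift-shift m (pairs m) (A ⊛ B) n ⟨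
  shift m (shift (pairs m) (A ⊛ B)) n ≡⟨ shift-cong m (⊛-shiftˡ (pairs m) A B) n ⟨
  Y m j n                             ∎
  where
  A = invPochQ m
  B = invPochQ2 j

term-identity : ∀ N → Diag N term ⊕ Diag⁻ N term ≗ invPochQ N
term-identity N n = begin
  Diag N term n + Diag⁻ N term n ≡⟨ cong₂ _+_ (Diag-cong N (λ m j _ → term≗Y m j) n) (lowerSum N) ⟩
  Diag N Y n + Diag⁻ N Y n       ≡⟨ S-split N n ⟨
  S N n                          ≡⟨ S≗invPochQ N n ⟩
  invPochQ N n                   ∎
  where
  lowerSum : ∀ N → Diag⁻ N term n ≡ Diag⁻ N Y n
  lowerSum zero    = refl
  lowerSum (suc N) = Diag-cong N (λ m j _ → term≗Y m j) n

-- The norm N l + k N(N-1)/2 of the smallest partition (l, l+k, …, l+(N-1)k)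
-- in UG_{k,l} with N parts.
base : ℕ → ℕ → ℕ → ℕ
base k l N = N * l + k * pairs N

tri-double : ∀ n → tri n * 2 ≡ n * suc n
tri-double zero    = refl
tri-double (suc n) = begin
  (tri n + suc n) * 2       ≡⟨ *-distribʳ-+ 2 (tri n) (suc n) ⟩
  tri n * 2 + suc n * 2     ≡⟨ cong (_+ suc n * 2) (tri-double n) ⟩
  n * suc n + suc n * 2     ≡⟨ step n ⟩
  suc n * suc (suc n)       ∎
  where
  step : ∀ n → n * (1 + n) + (1 + n) * 2 ≡ (1 + n) * (2 + n)
  step = solve-∀

halve-pairs : ∀ n → (n * (n ∸ 1)) / 2 ≡ pairs n
halve-pairs zero    = refl
halve-pairs (suc n) = begin
  (suc n * n) / 2 ≡⟨ cong (_/ 2) (trans (*-comm (suc n) n) (sym (tri-double n))) ⟩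
  (tri n * 2) / 2 ≡⟨ m*n/n≡m (tri n) 2 ⟩
  tri n           ∎

halve-tri : ∀ m → (m * (m + 1)) / 2 ≡ tri m
halve-tri m = begin
  (m * (m + 1)) / 2 ≡⟨ cong (λ x → (m * x) / 2) (+-comm m 1) ⟩
  (m * suc m) / 2   ≡⟨ cong (_/ 2) (sym (tri-double m)) ⟩
  (tri m * 2) / 2   ≡⟨ m*n/n≡m (tri m) 2 ⟩
  tri m             ∎

pairs-+ : ∀ m n → pairs (m + n) ≡ pairs m + pairs n + m * n
pairs-+ zero    n = sym (+-identityʳ (pairs n))
pairs-+ (suc m) n = begin
  tri (m + n)                                  ≡⟨ tri≡m+pairs (m + n) ⟩
  m + n + pairs (m + n)                        ≡⟨ cong (m + n +_) (pairs-+ m n) ⟩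
  m + n + (pairs m + pairs n + m * n)          ≡⟨ regroup m n (pairs m) (pairs n) ⟩
  m + pairs m + pairs n + suc m * n            ≡⟨ cong (λ x → x + pairs n + suc m * n) (tri≡m+pairs m) ⟨
  tri m + pairs n + suc m * n                  ∎
  where
  regroup : ∀ m n a b → m + n + (a + b + m * n) ≡ m + a + b + (1 + m) * n
  regroup = solve-∀

-- (n - 1) x + (x + y) = n x + y, the only place where Q leaves ℕ.
pred-mul : ∀ n x y → (pos n ℤ.- pos 1) ℤ.* pos x ℤ.+ pos (x + y) ≡ pos (n * x + y)
pred-mul n x y = begin
  (pos n ℤ.- pos 1) ℤ.* pos x ℤ.+ pos (x + y)         ≡⟨ cong (ℤ._+_ ((pos n ℤ.- pos 1) ℤ.* pos x)) (ℤP.pos-+ x y) ⟩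
  (pos n ℤ.- pos 1) ℤ.* pos x ℤ.+ (pos x ℤ.+ pos y)  ≡⟨ ring (pos n) (pos x) (pos y) ⟩
  pos n ℤ.* pos x ℤ.+ pos y                           ≡⟨ cong (ℤ._+ pos y) (ℤP.pos-* n x) ⟨
  pos (n * x) ℤ.+ pos y                               ≡⟨ ℤP.pos-+ (n * x) y ⟨
  pos (n * x + y)                                     ∎
  where
  ring : ∀ a b c → (a ℤ.- pos 1) ℤ.* b ℤ.+ (b ℤ.+ c) ≡ a ℤ.* b ℤ.+ c
  ring = ℤSolver.solve-∀

Q-closed : ∀ k l m n → Q k l m n ≡ pos (base k l (m + n) + tri m)
Q-closed k l m n = begin
  Q k l m n
    ≡⟨ cong₂ (λ p t → pos a ℤ.+ pos (k * p) ℤ.+ c ℤ.+ pos ((k + 1) * t)) (halve-pairs n) (halve-tri m) ⟩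
  pos a ℤ.+ pos (k * pairs n) ℤ.+ c ℤ.+ pos ((k + 1) * tri m)
    ≡⟨ ℤP.+-assoc (pos a ℤ.+ pos (k * pairs n)) c _ ⟩
  pos a ℤ.+ pos (k * pairs n) ℤ.+ (c ℤ.+ pos ((k + 1) * tri m))
    ≡⟨ cong (λ x → pos a ℤ.+ pos (k * pairs n) ℤ.+ (c ℤ.+ pos x)) (spread (tri m) (tri≡m+pairs m)) ⟩
  pos a ℤ.+ pos (k * pairs n) ℤ.+ (c ℤ.+ pos (m * k + (k * pairs m + tri m)))
    ≡⟨ cong (ℤ._+_ (pos a ℤ.+ pos (k * pairs n))) (pred-mul n (m * k) (k * pairs m + tri m)) ⟩
  pos a ℤ.+ pos (k * pairs n) ℤ.+ pos (n * (m * k) + (k * pairs m + tri m))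
    ≡⟨ cong (ℤ._+ pos (n * (m * k) + (k * pairs m + tri m))) (ℤP.pos-+ a (k * pairs n)) ⟨
  pos (a + k * pairs n) ℤ.+ pos (n * (m * k) + (k * pairs m + tri m))
    ≡⟨ ℤP.pos-+ (a + k * pairs n) _ ⟨
  pos (a + k * pairs n + (n * (m * k) + (k * pairs m + tri m)))
    ≡⟨ cong pos (trans (regroup a k n m (pairs m) (pairs n) (tri m)) (cong (λ p → a + k * p + tri m) (sym (pairs-+ m n)))) ⟩
  pos (base k l (m + n) + tri m) ∎
  where
  a = (m + n) * l
  c = (pos n ℤ.- pos 1) ℤ.* pos (m * k)
  spread : ∀ t → t ≡ m + pairs m → (k + 1) * t ≡ m * k + (k * pairs m + t)
  spread t refl = solve-∀-step k m (pairs m)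
    where
    solve-∀-step : ∀ k m p → (k + 1) * (m + p) ≡ m * k + (k * p + (m + p))
    solve-∀-step = solve-∀
  regroup : ∀ a k n m p₁ p₂ t → a + k * p₂ + (n * (m * k) + (k * p₁ + t)) ≡ a + k * (p₁ + p₂ + m * n) + t
  regroup = solve-∀

Q-closed-next : ∀ k l m n → Q k l m n ℤ.+ pos (l + (m + n) * k) ≡ pos (base k l (suc (m + n)) + tri m)
Q-closed-next k l m n = begin
  Q k l m n ℤ.+ pos (l + N * k)                     ≡⟨ cong (ℤ._+ pos (l + N * k)) (Q-closed k l m n) ⟩
  pos (base k l N + tri m) ℤ.+ pos (l + N * k)      ≡⟨ ℤP.pos-+ (base k l N + tri m) (l + N * k) ⟨
  pos (base k l N + tri m + (l + N * k))            ≡⟨ cong pos (regroup N l k (pairs N) (tri m)) ⟩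
  pos (suc N * l + k * (N + pairs N) + tri m)       ≡⟨ cong (λ x → pos (suc N * l + k * x + tri m)) (tri≡m+pairs N) ⟨
  pos (base k l (suc N) + tri m)                    ∎
  where
  N = m + n
  regroup : ∀ N l k p t → N * l + k * p + t + (l + N * k) ≡ (1 + N) * l + k * (N + p) + t
  regroup = solve-∀

shiftBy-nonneg : ∀ e f M j → pos M ℤ.- e ≡ pos j → shiftBy e f M ≡ f j
shiftBy-nonneg e f M j eq rewrite eq = refl

shiftBy-neg : ∀ e f M j → pos M ℤ.- e ≡ -[1+ j ] → shiftBy e f M ≡ 0
shiftBy-neg e f M j eq rewrite eq = refl

shiftBy-pos : ∀ E f → shiftBy (pos E) f ≗ shift E f
shiftBy-pos E f M with ≤-<-connex E M
... | inj₁ E≤M with m≤n⇒∃[o]m+o≡n E≤M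
...   | d , refl = begin
  shiftBy (pos E) f (E + d) ≡⟨ shiftBy-nonneg (pos E) f (E + d) d difference ⟩
  f d                       ≡⟨ shift-at E f d ⟨
  shift E f (E + d)         ∎
  where
  difference : pos (E + d) ℤ.- pos E ≡ pos d
  difference = begin
    pos (E + d) ℤ.- pos E ≡⟨ ℤP.[+m]-[+n]≡m⊖n (E + d) E ⟩
    (E + d) ℤ.⊖ E         ≡⟨ ℤP.⊖-≥ (m≤m+n E d) ⟩
    pos (E + d ∸ E)       ≡⟨ cong pos (m+n∸m≡n E d) ⟩
    pos d                 ∎
shiftBy-pos E f M | inj₂ M<E with m≤n⇒∃[o]m+o≡n M<E
...   | d , refl = begin
  shiftBy (pos (suc M + d)) f M ≡⟨ shiftBy-neg (pos (suc M + d)) f M d difference ⟩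
  0                             ≡⟨ shift-below (suc M + d) f M (m≤m+n (suc M) d) ⟨
  shift (suc M + d) f M         ∎
  where
  difference : pos M ℤ.- pos (suc M + d) ≡ -[1+ d ]
  difference = begin
    pos M ℤ.- pos (suc M + d)  ≡⟨ ℤP.[+m]-[+n]≡m⊖n M (suc M + d) ⟩
    M ℤ.⊖ (suc M + d)          ≡⟨ ℤP.⊖-< (m≤m+n (suc M) d) ⟩
    ℤ.- pos (suc M + d ∸ M)    ≡⟨ cong (ℤ.-_ ∘ pos) (+-∸-assoc 1 (m≤m+n M d)) ⟩
    ℤ.- pos (suc (M + d ∸ M))  ≡⟨ cong (ℤ.-_ ∘ pos ∘ suc) (m+n∸m≡n M d) ⟩
    -[1+ d ]                   ∎

indicator-yes : ∀ {a N} (x : ℕ) → a ≡ N → (if a ≡ᵇ N then x else 0) ≡ x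
indicator-yes {a} {N} x eq with a ≡ᵇ N | ≡⇒≡ᵇ a N eq
... | true  | _  = refl
... | false | ()

indicator-no : ∀ {a N} (x : ℕ) → a ≢ N → (if a ≡ᵇ N then x else 0) ≡ 0
indicator-no {a} {N} x ne with a ≡ᵇ N in eq
... | false = refl
... | true  = ⊥-elim (ne (≡ᵇ⇒≡ a N (subst T (sym eq) tt)))

sumTo-select : ∀ K c N (V : ℕ → ℕ) → c ≤ N → N ≤ K →
  sumTo K (λ m → if m + c ≡ᵇ N then V m else 0) ≡ V (N ∸ c)
sumTo-select K c N V c≤N N≤K = begin
  sumTo K (λ m → if m + c ≡ᵇ N then V m else 0)   ≡⟨ sumTo-single K (N ∸ c) _ (≤-trans (m∸n≤m N c) N≤K) others ⟩
  (if N ∸ c + c ≡ᵇ N then V (N ∸ c) else 0)       ≡⟨ indicator-yes (V (N ∸ c)) (m∸n+n≡m c≤N) ⟩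
  V (N ∸ c)                                       ∎
  where
  others : ∀ m → m ≤ K → m ≢ N ∸ c → (if m + c ≡ᵇ N then V m else 0) ≡ 0
  others m _ m≢N-c = indicator-no (V m) (λ eq → m≢N-c (trans (sym (m+n∸n≡m m c)) (cong (_∸ c) eq)))

sumTo-diagonal : ∀ N K L (H : ℕ → ℕ → Series) T (V : ℕ → ℕ → ℕ) → N ≤ K → N ≤ L →
  (∀ m j → m + 2 * j ≡ N → V m j ≡ H m j T) →
  sumTo K (λ m → sumTo L (λ n → if m + 2 * n ≡ᵇ N then V m n else 0)) ≡ Diag N H T
sumTo-diagonal zero K zero H T V N≤K N≤L onDiag =
  trans (sumTo-select K 0 0 (λ m → V m 0) z≤n z≤n) (onDiag 0 0 refl)
sumTo-diagonal N K (suc L) H T V N≤K N≤L onDiag = begin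
  sumTo K (λ m → sumTo (suc L) (λ n → if m + 2 * n ≡ᵇ N then V m n else 0))
    ≡⟨ sumTo-cong K (λ m _ → sumTo-suc L _) ⟩
  sumTo K (λ m → (if m + 0 ≡ᵇ N then V m 0 else 0) + rest m)
    ≡⟨ sumTo-+ K _ rest ⟩
  sumTo K (λ m → if m + 0 ≡ᵇ N then V m 0 else 0) + sumTo K rest
    ≡⟨ cong₂ _+_ (trans (sumTo-select K 0 N (λ m → V m 0) z≤n N≤K) (onDiag N 0 (+-identityʳ N))) (higher N N≤K N≤L onDiag) ⟩
  H N 0 T + Diag⁻₂ N (λ m j → H m (suc j)) T
    ≡⟨ peel N ⟩
  Diag N H T ∎
  where
  rest : ℕ → ℕ
  rest m = sumTo L (λ n → if m + 2 * suc n ≡ᵇ N then V m (suc n) else 0)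
  Diag⁻₂ : ℕ → (ℕ → ℕ → Series) → Series
  Diag⁻₂ (suc (suc N)) G = Diag N G
  Diag⁻₂ _             G = zeroS
  peel : ∀ N → H N 0 T + Diag⁻₂ N (λ m j → H m (suc j)) T ≡ Diag N H T
  peel zero          = +-identityʳ _
  peel (suc zero)    = +-identityʳ _
  peel (suc (suc N)) = refl
  higher : ∀ N → N ≤ K → N ≤ suc L → (∀ m j → m + 2 * j ≡ N → V m j ≡ H m j T) →
    sumTo K (λ m → sumTo L (λ n → if m + 2 * suc n ≡ᵇ N then V m (suc n) else 0)) ≡ Diag⁻₂ N (λ m j → H m (suc j)) T
  higher zero _ _ _ = sumTo-zero K _ (λ m _ → sumTo-zero L _ (λ n _ →
    indicator-no (V m (suc n)) (λ eq → 1+n≢0 (trans (sym (diag-step m n)) eq))))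
  higher (suc zero) _ _ _ = sumTo-zero K _ (λ m _ → sumTo-zero L _ (λ n _ →
    indicator-no (V m (suc n)) (λ eq → 1+n≢0 (suc-injective (trans (sym (diag-step m n)) eq)))))
  higher (suc (suc N)) N+2≤K (s≤s N+1≤L) onDiag = begin
    sumTo K (λ m → sumTo L (λ n → if m + 2 * suc n ≡ᵇ suc (suc N) then V m (suc n) else 0))
      ≡⟨ sumTo-cong K (λ m _ → sumTo-cong L (λ n _ → cong (λ a → if a ≡ᵇ suc (suc N) then V m (suc n) else 0) (diag-step m n))) ⟩
    sumTo K (λ m → sumTo L (λ n → if m + 2 * n ≡ᵇ N then V m (suc n) else 0))
      ≡⟨ sumTo-diagonal N K L (λ m j → H m (suc j)) T (λ m n → V m (suc n))
           (≤-trans (n≤1+n N) (≤-trans (n≤1+n (suc N)) N+2≤K)) (≤-trans (n≤1+n N) N+1≤L)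
           (λ m j eq → onDiag m (suc j) (trans (diag-step m j) (cong (suc ∘ suc) eq))) ⟩
    Diag N (λ m j → H m (suc j)) T ∎

Diag-suc : ∀ N H → Diag (suc N) H ≗ H (suc N) 0 ⊕ Diag⁻ N (λ m j → H m (suc j))
Diag-suc zero    H T = sym (+-identityʳ _)
Diag-suc (suc N) H T = refl

sumTo-parity : ∀ N H T → sumTo N (λ n → H (N ∸ n) ⌊ n /2⌋ T) ≡ Diag N H T + Diag⁻ N H T
sumTo-parity zero          H T = sym (+-identityʳ _)
sumTo-parity (suc zero)    H T = refl
sumTo-parity (suc (suc N)) H T = begin
  sumTo (suc (suc N)) f
    ≡⟨ sumTo-suc (suc N) f ⟩
  f 0 + sumTo (suc N) (f ∘ suc)
    ≡⟨ cong (f 0 +_) (sumTo-suc N (f ∘ suc)) ⟩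
  f 0 + (f 1 + sumTo N (λ n → H′ (N ∸ n) ⌊ n /2⌋ T))
    ≡⟨ cong (λ x → f 0 + (f 1 + x)) (sumTo-parity N H′ T) ⟩
  f 0 + (f 1 + (Diag N H′ T + Diag⁻ N H′ T))
    ≡⟨ +-assoc (f 0) (f 1) _ ⟨
  f 0 + f 1 + (Diag N H′ T + Diag⁻ N H′ T)
    ≡⟨ interchange (f 0) (f 1) (Diag N H′ T) (Diag⁻ N H′ T) ⟩
  f 0 + Diag N H′ T + (f 1 + Diag⁻ N H′ T)
    ≡⟨ cong (f 0 + Diag N H′ T +_) (Diag-suc N H T) ⟨
  Diag (suc (suc N)) H T + Diag⁻ (suc (suc N)) H T ∎
  where
  f : ℕ → ℕ
  f n = H (suc (suc N) ∸ n) ⌊ n /2⌋ T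
  H′ : ℕ → ℕ → Series
  H′ m j = H m (suc j)

/2≡⌊/2⌋ : ∀ n → n / 2 ≡ ⌊ n /2⌋
/2≡⌊/2⌋ zero          = refl
/2≡⌊/2⌋ (suc zero)    = refl
/2≡⌊/2⌋ (suc (suc n)) = trans (m/n≡1+[m∸n]/n {suc (suc n)} {2} (s≤s (s≤s z≤n))) (cong suc (/2≡⌊/2⌋ n))

shiftBy-split : ∀ {e} b t f → e ≡ pos (b + t) → shiftBy e f ≗ shift b (shift t f)
shiftBy-split b t f refl M = trans (shiftBy-pos (b + t) f M) (sym (shift-shift b t f M))

rhs1-closed : ∀ k l N M → rhs1 k l N M ≡ shift (base k l N) (invPochQ N) M
rhs1-closed k l N M = begin
  rhs1 k l N M
    ≡⟨ sumTo-swap N N (λ m n → if m + n ≡ᵇ N then V m n else 0) ⟩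
  sumTo N (λ n → sumTo N (λ m → if m + n ≡ᵇ N then V m n else 0))
    ≡⟨ sumTo-cong N (λ n n≤N → trans (sumTo-select N n N (λ m → V m n) n≤N ≤-refl) (onDiagonal n n≤N)) ⟩
  sumTo N (λ n → shift b (term (N ∸ n) ⌊ n /2⌋) M)
    ≡⟨ sumTo-shift N b (λ n → term (N ∸ n) ⌊ n /2⌋) M ⟩
  shift b (λ T → sumTo N (λ n → term (N ∸ n) ⌊ n /2⌋ T)) M
    ≡⟨ shift-cong b (λ T → trans (sumTo-parity N term T) (term-identity N T)) M ⟩
  shift b (invPochQ N) M ∎
  where
  b = base k l N
  V : ℕ → ℕ → ℕ
  V m n = shiftBy (Q k l m n) (invPochQ m ⊛ invPochQ2 (n / 2)) M
  onDiagonal : ∀ n → n ≤ N → V (N ∸ n) n ≡ shift b (term (N ∸ n) ⌊ n /2⌋) M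
  onDiagonal n n≤N = trans (cong (λ j → shiftBy (Q k l (N ∸ n) n) (invPochQ (N ∸ n) ⊛ invPochQ2 j) M) (/2≡⌊/2⌋ n))
    (shiftBy-split b (tri (N ∸ n)) _
      (trans (Q-closed k l (N ∸ n) n) (cong (λ x → pos (base k l x + tri (N ∸ n))) (m∸n+n≡m n≤N))) M)

evenCoeff : ℕ → ℕ → ℕ → ℕ → ℕ → ℕ
evenCoeff k l M m n = shiftBy (Q k l m (2 * n)) (invPochQ m ⊛ invPochQ2 n) M

oddCoeff : ℕ → ℕ → ℕ → ℕ → ℕ → ℕ
oddCoeff k l M m n = shiftBy (Q k l m (2 * n) ℤ.+ pos (l + (m + 2 * n) * k)) (invPochQ m ⊛ invPochQ2 n) M

rhs2-even : ∀ k l N M →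
  sumTo N (λ m → sumTo N (λ n → if m + 2 * n ≡ᵇ N then evenCoeff k l M m n else 0)) ≡ shift (base k l N) (Diag N term) M
rhs2-even k l N M = begin
  sumTo N (λ m → sumTo N (λ n → if m + 2 * n ≡ᵇ N then evenCoeff k l M m n else 0))
    ≡⟨ sumTo-diagonal N N N (λ m j → shift b (term m j)) M (evenCoeff k l M) ≤-refl ≤-refl onDiagonal ⟩
  Diag N (λ m j → shift b (term m j)) M
    ≡⟨ Diag-shift N b term M ⟩
  shift b (Diag N term) M ∎
  where
  b = base k l N
  onDiagonal : ∀ m j → m + 2 * j ≡ N → evenCoeff k l M m j ≡ shift b (term m j) M
  onDiagonal m j eq = shiftBy-split b (tri m) _ (trans (Q-closed k l m (2 * j)) (cong (λ x → pos (base k l x + tri m)) eq)) M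

rhs2-odd : ∀ k l N M →
  sumTo N (λ m → sumTo N (λ n → if m + 2 * n + 1 ≡ᵇ N then oddCoeff k l M m n else 0)) ≡ shift (base k l N) (Diag⁻ N term) M
rhs2-odd k l zero    M = sym (shift-zeroS (base k l 0) M)
rhs2-odd k l (suc N) M = begin
  sumTo (suc N) (λ m → sumTo (suc N) (λ n → if m + 2 * n + 1 ≡ᵇ suc N then oddCoeff k l M m n else 0))
    ≡⟨ sumTo-cong (suc N) (λ m _ → sumTo-cong (suc N) (λ n _ →
         cong (λ a → if a ≡ᵇ suc N then oddCoeff k l M m n else 0) (+-comm (m + 2 * n) 1))) ⟩
  sumTo (suc N) (λ m → sumTo (suc N) (λ n → if m + 2 * n ≡ᵇ N then oddCoeff k l M m n else 0))
    ≡⟨ sumTo-diagonal N (suc N) (suc N) (λ m j → shift b (term m j)) M (oddCoeff k l M) (n≤1+n N) (n≤1+n N) onDiagonal ⟩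
  Diag N (λ m j → shift b (term m j)) M
    ≡⟨ Diag-shift N b term M ⟩
  shift b (Diag N term) M ∎
  where
  b = base k l (suc N)
  onDiagonal : ∀ m j → m + 2 * j ≡ N → oddCoeff k l M m j ≡ shift b (term m j) M
  onDiagonal m j eq = shiftBy-split b (tri m) _ (trans (Q-closed-next k l m (2 * j)) (cong (λ x → pos (base k l (suc x) + tri m)) eq)) M

rhs2-closed : ∀ k l N M → rhs2 k l N M ≡ shift (base k l N) (invPochQ N) M
rhs2-closed k l N M = begin
  rhs2 k l N M
    ≡⟨ sumTo-cong N (λ m _ → sumTo-+ N (even m) (odd m)) ⟩
  sumTo N (λ m → sumTo N (even m) + sumTo N (odd m))
    ≡⟨ sumTo-+ N (λ m → sumTo N (even m)) (λ m → sumTo N (odd m)) ⟩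
  sumTo N (λ m → sumTo N (even m)) + sumTo N (λ m → sumTo N (odd m))
    ≡⟨ cong₂ _+_ (rhs2-even k l N M) (rhs2-odd k l N M) ⟩
  shift b (Diag N term) M + shift b (Diag⁻ N term) M
    ≡⟨ shift-⊕ b (Diag N term) (Diag⁻ N term) M ⟨
  shift b (Diag N term ⊕ Diag⁻ N term) M
    ≡⟨ shift-cong b (term-identity N) M ⟩
  shift b (invPochQ N) M ∎
  where
  b = base k l N
  even odd : ℕ → ℕ → ℕ
  even m n = if m + 2 * n ≡ᵇ N then evenCoeff k l M m n else 0
  odd  m n = if m + 2 * n + 1 ≡ᵇ N then oddCoeff k l M m n else 0

concatFrom : (ℕ → List (List ℕ)) → ℕ → ℕ → List (List ℕ)
concatFrom g x zero    = []
concatFrom g x (suc c) = g x ++ concatFrom g (suc x) c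

concatFrom-∈⁻ : ∀ g x c {π} → π ∈ concatFrom g x c → ∃ λ y → x ≤ y × y < x + c × π ∈ g y
concatFrom-∈⁻ g x (suc c) π∈ with ∈-++⁻ (g x) π∈
... | inj₁ π∈gx = x , ≤-refl , subst (x <_) (sym (+-suc x c)) (s≤s (m≤m+n x c)) , π∈gx
... | inj₂ π∈rest with concatFrom-∈⁻ g (suc x) c π∈rest
...   | y , x<y , y<x+1+c , π∈gy = y , <⇒≤ x<y , subst (y <_) (sym (+-suc x c)) y<x+1+c , π∈gy

concatFrom-∈⁺ : ∀ g x c {π} y → x ≤ y → y < x + c → π ∈ g y → π ∈ concatFrom g x c
concatFrom-∈⁺ g x zero    y x≤y y<x+0 _ = ⊥-elim (<-irrefl refl (≤-trans y<x+0 (subst (_≤ y) (sym (+-identityʳ x)) x≤y)))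
concatFrom-∈⁺ g x (suc c) y x≤y y<x+1+c π∈gy with m≤n⇒m<n∨m≡n x≤y
... | inj₂ refl = ∈-++⁺ˡ π∈gy
... | inj₁ x<y  = ∈-++⁺ʳ (g x) (concatFrom-∈⁺ g (suc x) c y x<y (subst (y <_) (+-suc x c) y<x+1+c) π∈gy)

concatFrom-unique : ∀ g x c → (∀ y → Unique (g y)) → (∀ y z {π} → π ∈ g y → π ∈ g z → y ≡ z) →
  Unique (concatFrom g x c)
concatFrom-unique g x zero    _      _        = []
concatFrom-unique g x (suc c) unique disjoint =
  Unique.++⁺ (unique x) (concatFrom-unique g (suc x) c unique disjoint) apart
  where
  apart : ∀ {π} → ¬ (π ∈ g x × π ∈ concatFrom g (suc x) c)
  apart (π∈gx , π∈rest) with concatFrom-∈⁻ g (suc x) c π∈rest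
  ... | y , x<y , _ , π∈gy = <-irrefl (disjoint x y π∈gx π∈gy) x<y

-- Partitions with N parts, norm M, smallest part ≥ a and gaps ≥ k (Gaps 0 and
-- positivity follow when a ≥ 1).
Admissible : ℕ → ℕ → ℕ → ℕ → List ℕ → Set
Admissible k a N M π = HeadGeq a π × Gaps k π × length π ≡ N × sum π ≡ M

admissible-∷⁻ : ∀ k a N M y ρ → Admissible k a (suc N) M (y ∷ ρ) →
  a ≤ y × y ≤ M × Admissible k (y + k) N (M ∸ y) ρ
admissible-∷⁻ k a N M y []      (a≤y , _ , len , sum≡) =
  a≤y , subst (y ≤_) sum≡ (m≤m+n y 0) , tt , tt , suc-injective len , trans (sym (m+n∸m≡n y 0)) (cong (_∸ y) sum≡)
admissible-∷⁻ k a N M y (z ∷ ρ) (a≤y , (y+k≤z , gaps) , len , sum≡) =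
  a≤y , subst (y ≤_) sum≡ (m≤m+n y _) , y+k≤z , gaps , suc-injective len , trans (sym (m+n∸m≡n y _)) (cong (_∸ y) sum≡)

admissible-∷⁺ : ∀ k a N M y ρ → a ≤ y → y ≤ M → Admissible k (y + k) N (M ∸ y) ρ →
  Admissible k a (suc N) M (y ∷ ρ)
admissible-∷⁺ k a N M y []      a≤y y≤M (_ , _ , len , sum≡) =
  a≤y , tt , cong suc len , trans (cong (y +_) sum≡) (m+[n∸m]≡n y≤M)
admissible-∷⁺ k a N M y (z ∷ ρ) a≤y y≤M (y+k≤z , gaps , len , sum≡) =
  a≤y , (y+k≤z , gaps) , cong suc len , trans (cong (y +_) sum≡) (m+[n∸m]≡n y≤M)

enum : ℕ → ℕ → ℕ → ℕ → List (List ℕ)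
enum k a zero    zero    = [] ∷ []
enum k a zero    (suc M) = []
enum k a (suc N) M       = concatFrom (λ y → map (y ∷_) (enum k (y + k) N (M ∸ y))) a (suc M ∸ a)

withSmallest : ℕ → ℕ → ℕ → ℕ → List (List ℕ)
withSmallest k N M y = map (y ∷_) (enum k (y + k) N (M ∸ y))

∈-withSmallest⁻ : ∀ k N M y {π} → π ∈ withSmallest k N M y → ∃ λ ρ → π ≡ y ∷ ρ × ρ ∈ enum k (y + k) N (M ∸ y)
∈-withSmallest⁻ k N M y π∈ with ∈-map⁻ (y ∷_) π∈
... | ρ , ρ∈ , refl = ρ , refl , ρ∈

in-range : ∀ a y M → a ≤ y → y < a + (suc M ∸ a) → y ≤ M
in-range a y M a≤y y<end with a ≤? suc M
... | yes a≤1+M = ≤-pred (subst (y <_) (m+[n∸m]≡n a≤1+M) y<end)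
... | no  a≰1+M = ⊥-elim (<-irrefl refl (≤-trans y<end (subst (_≤ y) (sym end≡a) a≤y)))
  where
  end≡a : a + (suc M ∸ a) ≡ a
  end≡a = trans (cong (a +_) (m≤n⇒m∸n≡0 (<⇒≤ (≰⇒> a≰1+M)))) (+-identityʳ a)

enum-sound : ∀ k a N M π → π ∈ enum k a N M → Admissible k a N M π
enum-sound k a zero    zero    .[] (here refl) = tt , tt , refl , refl
enum-sound k a (suc N) M       π   π∈ with concatFrom-∈⁻ (withSmallest k N M) a (suc M ∸ a) π∈
... | y , a≤y , y<end , π∈block with ∈-withSmallest⁻ k N M y π∈block
...   | ρ , refl , ρ∈ =
  admissible-∷⁺ k a N M y ρ a≤y (in-range a y M a≤y y<end) (enum-sound k (y + k) N (M ∸ y) ρ ρ∈)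

enum-complete : ∀ k a N M π → Admissible k a N M π → π ∈ enum k a N M
enum-complete k a zero    zero    []      _                 = here refl
enum-complete k a zero    (suc M) []      (_ , _ , _ , ())
enum-complete k a zero    M       (y ∷ ρ) (_ , _ , () , _)
enum-complete k a (suc N) M       []      (_ , _ , () , _)
enum-complete k a (suc N) M       (y ∷ ρ) adm with admissible-∷⁻ k a N M y ρ adm
... | a≤y , y≤M , adm′ =
  concatFrom-∈⁺ (withSmallest k N M) a (suc M ∸ a) y a≤y y<end
    (∈-map⁺ (y ∷_) (enum-complete k (y + k) N (M ∸ y) ρ adm′))
  where
  y<end : y < a + (suc M ∸ a)
  y<end = subst (y <_) (sym (m+[n∸m]≡n (≤-trans a≤y (m≤n⇒m≤1+n y≤M)))) (s≤s y≤M)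

enum-∈⇔ : ∀ k a N M π → π ∈ enum k a N M ⇔ Admissible k a N M π
enum-∈⇔ k a N M π = mk⇔ (enum-sound k a N M π) (enum-complete k a N M π)

enum-unique : ∀ k a N M → Unique (enum k a N M)
enum-unique k a zero    zero    = [] ∷ []
enum-unique k a zero    (suc M) = []
enum-unique k a (suc N) M       = concatFrom-unique (withSmallest k N M) a (suc M ∸ a)
  (λ y → Unique.map⁺ ∷-injectiveʳ (enum-unique k (y + k) N (M ∸ y)))
  (λ y z π∈y π∈z → smallest (∈-withSmallest⁻ k N M y π∈y) (∈-withSmallest⁻ k N M z π∈z))
  where
  smallest : ∀ {π y z} {L L′ : List (List ℕ)} →
    (∃ λ ρ → π ≡ y ∷ ρ × ρ ∈ L) → (∃ λ ρ → π ≡ z ∷ ρ × ρ ∈ L′) → y ≡ z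
  smallest (_ , refl , _) (_ , eq , _) = ∷-injectiveˡ eq

-- Splitting off the smallest part a:  q^{base a (N+1)} / (q;q)_{N+1}
--   = q^a · q^{base (a+k) N} / (q;q)_N + q^{base (a+1) (N+1)} / (q;q)_{N+1}.
count-recurrence : ∀ k a N M → a ≤ M →
  shift (base k a (suc N)) (invPochQ (suc N)) M ≡
  shift (base k (a + k) N) (invPochQ N) (M ∸ a) + shift (base k (suc a) (suc N)) (invPochQ (suc N)) M
count-recurrence k a N M a≤M = begin
  shift E (invPochQ (suc N)) M
    ≡⟨ shift-cong E (invPochQ-unfold N) M ⟩
  shift E (invPochQ N ⊕ shift (suc N) (invPochQ (suc N))) M
    ≡⟨ shift-⊕ E (invPochQ N) _ M ⟩
  shift E (invPochQ N) M + shift E (shift (suc N) (invPochQ (suc N))) M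
    ≡⟨ cong₂ _+_ (shift-index (invPochQ N) smallest M) (shift-shift E (suc N) _ M) ⟩
  shift (a + base k (a + k) N) (invPochQ N) M + shift (E + suc N) (invPochQ (suc N)) M
    ≡⟨ cong₂ _+_ (sym (shift-shift a _ (invPochQ N) M)) (shift-index (invPochQ (suc N)) next M) ⟩
  shift a (shift (base k (a + k) N) (invPochQ N)) M + shift (base k (suc a) (suc N)) (invPochQ (suc N)) M
    ≡⟨ cong (_+ shift (base k (suc a) (suc N)) (invPochQ (suc N)) M) (shift-≥ a _ M a≤M) ⟩
  shift (base k (a + k) N) (invPochQ N) (M ∸ a) + shift (base k (suc a) (suc N)) (invPochQ (suc N)) M ∎
  where
  E = base k a (suc N)
  smallest : E ≡ a + base k (a + k) N
  smallest = trans (cong (λ t → suc N * a + k * t) (tri≡m+pairs N)) (ring a N k (pairs N))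
    where
    ring : ∀ a N k p → (1 + N) * a + k * (N + p) ≡ a + (N * (a + k) + k * p)
    ring = solve-∀
  next : E + suc N ≡ base k (suc a) (suc N)
  next = ring a N (k * tri N)
    where
    ring : ∀ a N x → (1 + N) * a + x + (1 + N) ≡ (1 + N) * (1 + a) + x
    ring = solve-∀

enum-length : ∀ k a N M → length (enum k a N M) ≡ shift (base k a N) (invPochQ N) M
enum-length k a zero    M = trans (empty M) (sym (shift-index one (*-zeroʳ k) M))
  where
  empty : ∀ M → length (enum k a zero M) ≡ one M
  empty zero    = refl
  empty (suc M) = refl
enum-length k a (suc N) M = blocks a (suc M ∸ a) refl
  where
  blocks : ∀ a c → suc M ∸ a ≡ c →
    length (concatFrom (withSmallest k N M) a c) ≡ shift (base k a (suc N)) (invPochQ (suc N)) M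
  blocks a zero    eq = sym (shift-below (base k a (suc N)) _ M (<-≤-trans M<a a≤base))
    where
    M<a : M < a
    M<a = m∸n≡0⇒m≤n eq
    a≤base : a ≤ base k a (suc N)
    a≤base = ≤-trans (m≤m+n a (N * a)) (m≤m+n (suc N * a) (k * tri N))
  blocks a (suc c) eq = begin
    length (withSmallest k N M a ++ concatFrom (withSmallest k N M) (suc a) c)
      ≡⟨ length-++ (withSmallest k N M a) ⟩
    length (withSmallest k N M a) + length (concatFrom (withSmallest k N M) (suc a) c)
      ≡⟨ cong₂ _+_ (trans (length-map (a ∷_) (enum k (a + k) N (M ∸ a))) (enum-length k (a + k) N (M ∸ a)))
                   (blocks (suc a) c (suc-injective (trans (sym (+-∸-assoc 1 a≤M)) eq))) ⟩
    shift (base k (a + k) N) (invPochQ N) (M ∸ a) + shift (base k (suc a) (suc N)) (invPochQ (suc N)) M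
      ≡⟨ count-recurrence k a N M a≤M ⟨
    shift (base k a (suc N)) (invPochQ (suc N)) M ∎
    where
    a≤M : a ≤ M
    a≤M = ≤-pred (m∸n≢0⇒n<m (λ empty → 0≢1+n (trans (sym empty) eq)))

gaps-positive : ∀ k a π → 1 ≤ a → HeadGeq a π → Gaps k π → All (0 <_) π
gaps-positive k a []          _   _   _               = []
gaps-positive k a (x ∷ [])    1≤a a≤x _               = ≤-trans 1≤a a≤x ∷ []
gaps-positive k a (x ∷ y ∷ ρ) 1≤a a≤x (x+k≤y , gaps) =
  ≤-trans 1≤a a≤x ∷ gaps-positive k (x + k) (y ∷ ρ) (≤-trans (≤-trans 1≤a a≤x) (m≤m+n x k)) x+k≤y gaps

gaps-weaken : ∀ k π → Gaps k π → Gaps 0 π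
gaps-weaken k []          _               = tt
gaps-weaken k (x ∷ [])    _               = tt
gaps-weaken k (x ∷ y ∷ ρ) (x+k≤y , gaps) = ≤-trans (≤-reflexive (+-identityʳ x)) (≤-trans (m≤m+n x k) x+k≤y) , gaps-weaken k (y ∷ ρ) gaps

UG⇔Admissible : ∀ k l N M π → 1 ≤ l → (UG k l π × length π ≡ N × sum π ≡ M) ⇔ Admissible k l N M π
UG⇔Admissible k l N M π 1≤l = mk⇔
  (λ { ((_ , head , gaps) , len , sum≡) → head , gaps , len , sum≡ })
  (λ { (head , gaps , len , sum≡) → ((gaps-positive k l π 1≤l head gaps , gaps-weaken k π gaps) , head , gaps) , len , sum≡ })

theorem2p3 : (k l : ℕ) → 1 ≤ l → (N M : ℕ) →
    Σ (List (List ℕ)) λ L →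
    Unique L
    × ((π : List ℕ) → (π ∈ L) ⇔ (UG k l π × length π ≡ N × sum π ≡ M))
    × length L ≡ rhs1 k l N M
    × length L ≡ rhs2 k l N M
theorem2p3 k l 1≤l N M =
  enum k l N M ,
  enum-unique k l N M ,
  (λ π → ⇔.trans (enum-∈⇔ k l N M π) (⇔.sym (UG⇔Admissible k l N M π 1≤l))) ,
  counts (rhs1-closed k l N M) ,
  counts (rhs2-closed k l N M)
  where
  counts : ∀ {r} → r ≡ shift (base k l N) (invPochQ N) M → length (enum k l N M) ≡ r
  counts r≡ = trans (enum-length k l N M) (sym r≡)
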